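{- Let $H$ be a spidey with a short leg $v$, and let $K$ be a finite tree. Let $G$ be the graph obtained from $H$ and $K$ by identifying $v$ with a vertex of $K$. Then $G$ admits a $3$-liec in which all edges of $E(H)$ receive the same color.
   Context: All graphs are simple and finite. A graph is locally irregular if the two end-vertices of every edge have distinct degrees. A $3$-liec of a graph is an edge coloring with colors from a set of $3$ colors such that each color class induces a locally irregular subgraph. A spidey is a tree of radius at most two consisting of a central vertex $u$ of degree at least $3$, where every other vertex has degree at most $2$ and is at distance at most $2$ from $u$. A short leg of a spidey is a leaf adjacent to the central vertex. -}

module Defs where

open import Data.Nat using (ℕ; zero; suc; _+_; _≤_)
open import Data.Fin using (Fin; zero; suc; inject₁; fromℕ)
open import Data.Fin.Properties using (_≟_)
open import Data.List using (List; map; allFin)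
open import Data.Nat.ListAction using (sum)
open import Data.Bool using (Bool; true; false; if_then_else_; _∧_)
open import Data.Product using (Σ; ∃; _×_; _,_)
open import Data.Sum using (_⊎_)
open import Relation.Nullary using (¬_)
open import Relation.Nullary.Decidable using (⌊_⌋)
open import Relation.Binary.PropositionalEquality using (_≡_; _≢_)
open import Function.Definitions using (Injective)

record Graph (n : ℕ) : Set where
  field
    adj    : Fin n → Fin n → Bool
    sym    : ∀ x y → adj x y ≡ adj y x
    irrefl : ∀ x → adj x x ≡ false
open Graph public

Adj : ∀ {n} → Graph n → Fin n → Fin n → Set
Adj G x y = adj G x y ≡ true

count : ∀ {n} → (Fin n → Bool) → ℕ
count {n} p = sum (map (λ w → if p w then 1 else 0) (allFin n))

deg : ∀ {n} → Graph n → Fin n → ℕ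
deg G u = count (adj G u)

data Walk {n} (G : Graph n) : Fin n → Fin n → Set where
  here : ∀ {x} → Walk G x x
  step : ∀ {x z y} → Adj G x z → Walk G z y → Walk G x y

Connected : ∀ {n} → Graph n → Set
Connected G = ∀ x y → Walk G x y

record Cycle {n} (G : Graph n) : Set where
  field
    k     : ℕ
    f     : Fin (3 + k) → Fin n
    inj   : Injective _≡_ _≡_ f
    cons  : ∀ (i : Fin (2 + k)) → Adj G (f (inject₁ i)) (f (suc i))
    close : Adj G (f (fromℕ (2 + k))) (f zero)

Acyclic : ∀ {n} → Graph n → Set
Acyclic G = ¬ Cycle G

IsTree : ∀ {n} → Graph n → Set
IsTree {n} G = Fin n × Connected G × Acyclic G

IsSpideyCenter : ∀ {n} → Graph n → Fin n → Set
IsSpideyCenter {n} G u =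
  (3 ≤ deg G u) ×
  (∀ x → x ≢ u → deg G x ≤ 2) ×
  (∀ x → x ≡ u ⊎ Adj G u x ⊎ (∃ λ y → Adj G u y × Adj G y x))

IsSpidey : ∀ {n} → Graph n → Set
IsSpidey G = IsTree G × ∃ λ u → IsSpideyCenter G u

IsSpideyWithShortLeg : ∀ {n} → Graph n → Fin n → Set
IsSpideyWithShortLeg H v =
  IsTree H × ∃ λ u → IsSpideyCenter H u × Adj H u v × deg H v ≡ 1

-- G (on Fin n) is (isomorphic to) the graph obtained from H and K by
-- identifying vertex v of H with vertex w of K; fH, fK are the embeddings.
record Glued {h k n} (H : Graph h) (v : Fin h) (K : Graph k) (w : Fin k)
             (G : Graph n) : Set where
  field
    fH      : Fin h → Fin n
    fK      : Fin k → Fin n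
    fH-inj  : Injective _≡_ _≡_ fH
    fK-inj  : Injective _≡_ _≡_ fK
    glue    : fH v ≡ fK w
    meet    : ∀ a b → fH a ≡ fK b → (a ≡ v) × (b ≡ w)
    cover   : ∀ x → (∃ λ a → fH a ≡ x) ⊎ (∃ λ b → fK b ≡ x)
    edges→  : ∀ x y → Adj G x y →
                (∃ λ a → ∃ λ b → fH a ≡ x × fH b ≡ y × Adj H a b) ⊎
                (∃ λ a → ∃ λ b → fK a ≡ x × fK b ≡ y × Adj K a b)
    H→G     : ∀ a b → Adj H a b → Adj G (fH a) (fH b)
    K→G     : ∀ a b → Adj K a b → Adj G (fK a) (fK b)

-- Edge colourings with 3 colours: a symmetric colour function on pairs
-- (only its values on edges matter).
record EdgeColoring3 {n} (G : Graph n) : Set where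
  field
    col     : Fin n → Fin n → Fin 3
    col-sym : ∀ x y → col x y ≡ col y x
open EdgeColoring3 public

colDeg : ∀ {n} {G : Graph n} → EdgeColoring3 G → Fin 3 → Fin n → ℕ
colDeg {G = G} c i u = count (λ x → adj G u x ∧ ⌊ col c u x ≟ i ⌋)

Is3Liec : ∀ {n} {G : Graph n} → EdgeColoring3 G → Set
Is3Liec {n} {G} c =
  ∀ x y → Adj G x y → colDeg c (col c x y) x ≢ colDeg c (col c x y) y

-- Root G at the centre u of the spidey: H is rooted at u and K hangs below v. Colour top-down.
-- All edges at u get one colour; a vertex x whose parent edge has colour a, while its parent has
-- degree t in colour a, colours the edges to its children so that its own degree in a differs from t
-- and every child gets a parent degree it can live with. Only the tops of pendant paths are picky:
-- a pendant path with an even number of edges cannot take t = 1, an odd one cannot take t = 2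
-- (computed bottom-up). With c ≥ 3 children all child edges keep colour a unless t = c + 1; one or
-- two children need a short case analysis. Since u has at least three children, every demand below
-- it is met. An edge of H not at u joins a child x ≠ v of u to its only child, a leaf, and such an
-- edge keeps the colour of the edge above it.

module Submission where

open import Defs hiding (sym)
open import Data.Bool using (Bool; true; false; if_then_else_; _∧_; _∨_; not)
open import Data.Bool.Properties using (∧-identityʳ; ∧-zeroʳ; ∨-identityʳ; ¬-not) renaming (_≟_ to _≟ᵇ_)
open import Data.Empty using (⊥; ⊥-elim)
open import Data.Fin using (Fin; zero; suc; inject₁; fromℕ)
open import Data.Fin.Properties using (_≟_; any?; suc-injective)
open import Data.List using (List; []; _∷_; _∷ʳ_; length; lookup; map; allFin)
open import Data.List.Extrema.Nat using (max; v≤max⁺)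
open import Data.List.Membership.Propositional.Properties using (∈-lookup; ∈-map⁺; ∈-allFin)
open import Data.List.Properties using (map-tabulate)
open import Data.List.Relation.Unary.All using (All; []; _∷_)
import Data.List.Relation.Unary.All as All
open import Data.List.Relation.Unary.All.Properties using (∷ʳ⁺)
open import Data.List.Relation.Unary.AllPairs using ([]; _∷_)
import Data.List.Relation.Unary.Any as Any
open import Data.List.Relation.Unary.Linked using (Linked; []; [-]; _∷_)
open import Data.List.Relation.Unary.Unique.Propositional using (Unique)
open import Data.Nat using (ℕ; zero; suc; _+_; _≤_; _<_; _∸_; z≤n; s≤s; pred; _<ᵇ_)
open import Data.Nat.ListAction using (sum)
open import Data.Nat.Properties
  using ( +-comm; +-identityʳ; +-mono-≤; +-suc; 1+n≰n; <-asym; <-cmp; <ᵇ⇒<; <⇒<ᵇ; <⇒≢; <⇒≱; m∸n≡0⇒m≤n; m≤n+m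
        ; m≤n⇒m≤1+n; n≤0⇒n≡0; n≤1+n; pred[m∸n]≡m∸[1+n]; ≤-antisym; ≤-pred; ≤-refl; ≤-reflexive; ≤-trans; ≮⇒≥ )
  renaming (_≟_ to _≟ℕ_)
import Data.Nat.Properties as ℕ
open import Algebra.Properties.CommutativeSemigroup ℕ.+-commutativeSemigroup using (interchange)
open import Data.Product using (Σ; ∃; _×_; _,_; proj₁; proj₂)
open import Data.Sum using (_⊎_; inj₁; inj₂)
open import Data.Unit using (⊤; tt)
open import Function using (_∘_; id)
open import Function.Definitions using (Injective)
open import Relation.Binary.Definitions using (tri<; tri≈; tri>)
open import Relation.Binary.PropositionalEquality
open import Relation.Nullary using (yes; no; Dec; does; contradiction)
open import Relation.Nullary.Decidable using (dec-true; dec-false; isYes≗does)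

private
  variable
    m n : ℕ

-- Counting

-- `does` rather than `⌊_⌋`: only the former computes through the `map′` in `suc x ≟ suc y`.
_==_ : Fin n → Fin n → Bool
x == y = does (x ≟ y)

==-≡ : {x y : Fin n} → (x == y) ≡ true → x ≡ y
==-≡ {x = x} {y} eq with x ≟ y
... | yes x≡y = x≡y

∧-true : ∀ {a b} → (a ∧ b) ≡ true → a ≡ true × b ≡ true
∧-true {true} {true} _ = refl , refl

indicator : Bool → ℕ
indicator b = if b then 1 else 0

count-suc : (p : Fin (suc n) → Bool) → count p ≡ indicator (p zero) + count (p ∘ suc)
count-suc p = trans (cong sum (map-tabulate id (indicator ∘ p)))
                    (cong (indicator (p zero) +_) (sym (cong sum (map-tabulate id (indicator ∘ p ∘ suc)))))

count-cong : (p q : Fin n → Bool) → (∀ z → p z ≡ q z) → count p ≡ count q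
count-cong {zero} p q p≗q = refl
count-cong {suc n} p q p≗q rewrite count-suc p | count-suc q | p≗q zero =
  cong (_ +_) (count-cong (p ∘ suc) (q ∘ suc) (p≗q ∘ suc))

count-none : (p : Fin n → Bool) → (∀ z → p z ≡ false) → count p ≡ 0
count-none {zero} p none = refl
count-none {suc n} p none rewrite count-suc p | none zero = count-none (p ∘ suc) (none ∘ suc)

count-mono : (p q : Fin n → Bool) → (∀ z → p z ≡ true → q z ≡ true) → count p ≤ count q
count-mono {zero} p q p⊆q = z≤n
count-mono {suc n} p q p⊆q rewrite count-suc p | count-suc q =
  +-mono-≤ (indicator-mono (p⊆q zero)) (count-mono (p ∘ suc) (q ∘ suc) (p⊆q ∘ suc))
  where
  indicator-mono : ∀ {a b} → (a ≡ true → b ≡ true) → indicator a ≤ indicator b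
  indicator-mono {false} _ = z≤n
  indicator-mono {true} a⇒b rewrite a⇒b refl = ≤-refl

count-pos : (p : Fin n → Bool) {x : Fin n} → p x ≡ true → 0 < count p
count-pos p {zero} px rewrite count-suc p | px = s≤s z≤n
count-pos p {suc x} px rewrite count-suc p =
  ≤-trans (count-pos (p ∘ suc) px) (m≤n+m _ (indicator (p zero)))

count-witness : (p : Fin n → Bool) → 0 < count p → ∃ λ x → p x ≡ true
count-witness {suc n} p pos rewrite count-suc p with p zero in p0
... | true = zero , p0
... | false with count-witness (p ∘ suc) pos
... | x , px = suc x , px

count-+ : (p q s : Fin n → Bool) → (∀ z → indicator (p z) ≡ indicator (q z) + indicator (s z)) →
          count p ≡ count q + count s
count-+ {zero} p q s split = refl
count-+ {suc n} p q s split
  rewrite count-suc p | count-suc q | count-suc s | split zero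
        | count-+ (p ∘ suc) (q ∘ suc) (s ∘ suc) (split ∘ suc) =
  interchange (indicator (q zero)) (indicator (s zero)) _ _

count-point : (x : Fin n) → count (_== x) ≡ 1
count-point {suc n} zero =
  trans (count-suc {n} (_== zero)) (cong suc (count-none {n} ((_== zero) ∘ suc) (λ _ → refl)))
count-point {suc n} (suc x) = trans (count-suc {n} (_== suc x)) (count-point x)

_∖_ : (Fin n → Bool) → Fin n → Fin n → Bool
(p ∖ x) z = p z ∧ not (z == x)

∖-intro : (p : Fin n → Bool) {x z : Fin n} → p z ≡ true → z ≢ x → (p ∖ x) z ≡ true
∖-intro p {x} {z} pz z≢x rewrite pz | dec-false (z ≟ x) z≢x = refl

count-remove : (p : Fin n → Bool) {x : Fin n} → p x ≡ true → count p ≡ suc (count (p ∖ x))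
count-remove p {x} px = begin
  count p                         ≡⟨ count-+ p (p ∖ x) (_== x) split ⟩
  count (p ∖ x) + count (_== x)   ≡⟨ cong (count (p ∖ x) +_) (count-point x) ⟩
  count (p ∖ x) + 1               ≡⟨ +-comm (count (p ∖ x)) 1 ⟩
  suc (count (p ∖ x))             ∎
  where
  open ≡-Reasoning
  split : ∀ z → indicator (p z) ≡ indicator ((p ∖ x) z) + indicator (z == x)
  split z with z ≟ x
  ... | yes refl rewrite px = refl
  ... | no _ with p z
  ...   | true = refl
  ...   | false = refl

count-unique : (p : Fin n → Bool) → count p ≤ 1 → {x y : Fin n} → p x ≡ true → p y ≡ true → x ≡ y
count-unique p atMostOne {x} {y} px py with y ≟ x
... | yes y≡x = sym y≡x
... | no y≢x = ⊥-elim (<⇒≱ (s≤s (count-pos (p ∖ x) (∖-intro p py y≢x))) (subst (_≤ 1) (count-remove p px) atMostOne))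

count-one : (p : Fin n → Bool) {y : Fin n} → p y ≡ true → (∀ z → p z ≡ true → z ≡ y) → count p ≡ 1
count-one p {y} py only = trans (count-remove p py) (cong suc (count-none (p ∖ y) none))
  where
  none : ∀ z → (p ∖ y) z ≡ false
  none z with p z in pz
  ... | false = refl
  ... | true rewrite dec-true (z ≟ y) (only z pz) = refl

count-< : (p q : Fin n → Bool) → (∀ z → p z ≡ true → q z ≡ true) →
          {w : Fin n} → q w ≡ true → p w ≡ false → count p < count q
count-< p q p⊆q {w} qw pw =
  subst (count p <_) (sym (count-remove q qw)) (s≤s (count-mono p (q ∖ w) p⊆q∖w))
  where
  p⊆q∖w : ∀ z → p z ≡ true → (q ∖ w) z ≡ true
  p⊆q∖w z pz = ∖-intro q (p⊆q z pz) λ { refl → contradiction (trans (sym pz) pw) λ () }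

count-≤-injective : (p : Fin m → Bool) (q : Fin n → Bool) {f : Fin m → Fin n} → Injective _≡_ _≡_ f →
                    (∀ z → p z ≡ true → q (f z) ≡ true) → count p ≤ count q
count-≤-injective {zero} p q f-inj p⇒qf = z≤n
count-≤-injective {suc m} p q {f} f-inj p⇒qf rewrite count-suc p with p zero in p0
... | false = count-≤-injective (p ∘ suc) q (suc-injective ∘ f-inj) (p⇒qf ∘ suc)
... | true = subst (suc (count (p ∘ suc)) ≤_) (sym (count-remove q (p⇒qf zero p0)))
               (s≤s (count-≤-injective (p ∘ suc) (q ∖ f zero) (suc-injective ∘ f-inj) avoids))
  where
  avoids : ∀ z → p (suc z) ≡ true → (q ∖ f zero) (f (suc z)) ≡ true
  avoids z pz = ∖-intro q (p⇒qf (suc z) pz) (λ e → contradiction (f-inj e) λ ())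

count-at : (x : Fin n) (b : Bool) → count (λ y → (y == x) ∧ b) ≡ indicator b
count-at x true = trans (count-cong (λ y → (y == x) ∧ true) (_== x) (λ y → ∧-identityʳ (y == x))) (count-point x)
count-at x false = count-none (λ y → (y == x) ∧ false) (λ y → ∧-zeroʳ (y == x))

any-true? : (p : Fin n → Bool) → Dec (∃ λ z → p z ≡ true)
any-true? p = any? (λ z → p z ≟ᵇ true)

least : (ℕ → Bool) → ℕ → ℕ
least p zero = zero
least p (suc b) = if p zero then zero else suc (least (p ∘ suc) b)

least-holds : (p : ℕ → Bool) (b : ℕ) → p b ≡ true → p (least p b) ≡ true
least-holds p zero pb = pb
least-holds p (suc b) pb with p zero in p0
... | true = p0
... | false = least-holds (p ∘ suc) b pb

least-minimal : (p : ℕ → Bool) (b : ℕ) {j : ℕ} → j < least p b → p j ≡ false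
least-minimal p (suc b) {j} j<least with p zero in p0
least-minimal p (suc b) {zero} j<least | false = p0
least-minimal p (suc b) {suc j} (s≤s j<least) | false = least-minimal (p ∘ suc) b j<least

-- Rooted graphs and trees

Adj-sym : (G : Graph n) {x y : Fin n} → Adj G x y → Adj G y x
Adj-sym G {x} {y} xy = trans (Graph.sym G y x) xy

non-adjacent : (G : Graph n) {x y : Fin n} → adj G x y ≡ false → Adj G x y → ⊥
non-adjacent G x≁y x~y = contradiction (trans (sym x~y) x≁y) λ ()

Adj-irrefl : (G : Graph n) {x y : Fin n} → Adj G x y → x ≢ y
Adj-irrefl G {x} xx refl = contradiction (trans (sym xx) (irrefl G x)) λ ()

record Rooting (G : Graph n) (r : Fin n) : Set where
  field
    parent       : Fin n → Fin n
    depth        : Fin n → ℕ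
    depth-root   : depth r ≡ 0
    parent-adj   : ∀ {x} → x ≢ r → Adj G x (parent x)
    depth-parent : ∀ {x} → x ≢ r → depth x ≡ suc (depth (parent x))
    edge-parent  : ∀ {x y} → Adj G x y → (parent y ≡ x × y ≢ r) ⊎ (parent x ≡ y × x ≢ r)

  depth-zero : ∀ {x} → depth x ≡ 0 → x ≡ r
  depth-zero {x} d≡0 with x ≟ r
  ... | yes x≡r = x≡r
  ... | no x≢r = contradiction (trans (sym (depth-parent x≢r)) d≡0) λ ()

  depth-adj : ∀ {x y} → Adj G x y → depth y ≤ suc (depth x)
  depth-adj {x} xy with edge-parent xy
  ... | inj₁ (refl , y≢r) = ≤-reflexive (depth-parent y≢r)
  ... | inj₂ (refl , x≢r) = m≤n⇒m≤1+n (subst (depth (parent x) ≤_) (sym (depth-parent x≢r)) (n≤1+n _))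

  child : Fin n → Fin n → Bool
  child x z = (parent z == x) ∧ not (z == r)

  children : Fin n → ℕ
  children x = count (child x)

  child-intro : ∀ {x z} → parent z ≡ x → z ≢ r → child x z ≡ true
  child-intro {x} {z} z↑x z≢r rewrite dec-true (parent z ≟ x) z↑x | dec-false (z ≟ r) z≢r = refl

  child-elim : ∀ {x z} → child x z ≡ true → parent z ≡ x × z ≢ r
  child-elim {x} {z} cz with parent z ≟ x | z ≟ r | cz
  ... | yes z↑x | no z≢r | _ = z↑x , z≢r

  depth-child : ∀ {x z} → child x z ≡ true → depth z ≡ suc (depth x)
  depth-child cz with child-elim cz
  ... | refl , z≢r = depth-parent z≢r

  child-adj : ∀ {x z} → child x z ≡ true → Adj G x z
  child-adj cz with child-elim cz
  ... | refl , z≢r = Adj-sym G (parent-adj z≢r)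

  child-asym : ∀ {x y} → child x y ≡ true → child y x ≡ true → ⊥
  child-asym cy cx = 1+n≰n (≤-trans (n≤1+n _) (≤-reflexive (sym (trans (depth-child cy) (cong suc (depth-child cx))))))

lastOf : {A : Set} → A → List A → A
lastOf x [] = x
lastOf x (y ∷ ys) = lastOf y ys

module _ {A : Set} {R : A → A → Set} where

  Linked-∷ʳ : (x : A) (xs : List A) {y z : A} → Linked R (x ∷ xs ∷ʳ y) → R y z → Linked R (x ∷ (xs ∷ʳ y) ∷ʳ z)
  Linked-∷ʳ x [] (xy ∷ [-]) yz = xy ∷ yz ∷ [-]
  Linked-∷ʳ x (x′ ∷ xs) (xx′ ∷ rest) yz = xx′ ∷ Linked-∷ʳ x′ xs rest yz

  Linked-lookup : (x : A) (xs : List A) → Linked R (x ∷ xs) →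
                  (i : Fin (length xs)) → R (lookup (x ∷ xs) (inject₁ i)) (lookup (x ∷ xs) (suc i))
  Linked-lookup x (x′ ∷ xs) (xx′ ∷ rest) zero = xx′
  Linked-lookup x (x′ ∷ xs) (xx′ ∷ rest) (suc i) = Linked-lookup x′ xs rest i

lastOf-∷ʳ : {A : Set} (x : A) (xs : List A) (y : A) → lastOf x (xs ∷ʳ y) ≡ y
lastOf-∷ʳ x [] y = refl
lastOf-∷ʳ x (x′ ∷ xs) y = lastOf-∷ʳ x′ xs y

lookup-last : {A : Set} (x : A) (xs : List A) → lookup (x ∷ xs) (fromℕ (length xs)) ≡ lastOf x xs
lookup-last x [] = refl
lookup-last x (x′ ∷ xs) = lookup-last x′ xs

Unique-∷ʳ : {A : Set} (xs : List A) {y : A} → Unique xs → All (_≢ y) xs → Unique (xs ∷ʳ y)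
Unique-∷ʳ [] [] [] = [] ∷ []
Unique-∷ʳ (x ∷ xs) (x∉xs ∷ u) (x≢y ∷ xs≢y) = ∷ʳ⁺ x∉xs x≢y ∷ Unique-∷ʳ xs u xs≢y

Unique-lookup-injective : {A : Set} (xs : List A) → Unique xs → ∀ i j → lookup xs i ≡ lookup xs j → i ≡ j
Unique-lookup-injective (x ∷ xs) u zero zero eq = refl
Unique-lookup-injective (x ∷ xs) (x∉xs ∷ u) zero (suc j) eq = ⊥-elim (All.lookup x∉xs (∈-lookup j) eq)
Unique-lookup-injective (x ∷ xs) (x∉xs ∷ u) (suc i) zero eq = ⊥-elim (All.lookup x∉xs (∈-lookup i) (sym eq))
Unique-lookup-injective (x ∷ xs) (x∉xs ∷ u) (suc i) (suc j) eq = cong suc (Unique-lookup-injective xs u i j eq)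

linkedCycle : (G : Graph n) (a b c : Fin n) (rest : List (Fin n)) → Linked (Adj G) (a ∷ b ∷ c ∷ rest) →
              Unique (a ∷ b ∷ c ∷ rest) → Adj G (lastOf c rest) a → Cycle G
linkedCycle G a b c rest linked unique closing = record
  { k     = length rest
  ; f     = lookup (a ∷ b ∷ c ∷ rest)
  ; inj   = Unique-lookup-injective (a ∷ b ∷ c ∷ rest) unique _ _
  ; cons  = Linked-lookup a (b ∷ c ∷ rest) linked
  ; close = subst (λ z → Adj G z a) (sym (lookup-last a (b ∷ c ∷ rest))) closing
  }

pathCycle : (G : Graph n) (a b : Fin n) (M : List (Fin n)) (c : Fin n) →
            Linked (Adj G) (a ∷ b ∷ M ∷ʳ c) → Unique (a ∷ b ∷ M ∷ʳ c) → Adj G c a → Cycle G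
pathCycle G a b [] c = linkedCycle G a b c []
pathCycle G a b (m ∷ M) c linked unique closing =
  linkedCycle G a b m (M ∷ʳ c) linked unique (subst (λ z → Adj G z a) (sym (lastOf-∷ʳ m M c)) closing)

module TreeRooting (T : Graph n) (r : Fin n) (connected : Connected T) (acyclic : Acyclic T) where

  reach : ℕ → Fin n → Bool
  reach zero x = x == r
  reach (suc j) x = reach j x ∨ does (any-true? (λ y → adj T x y ∧ reach j y))

  reach-step : ∀ j {x y} → Adj T x y → reach j y ≡ true → reach (suc j) x ≡ true
  reach-step j {x} {y} xy reach-y with reach j x
  ... | true = refl
  ... | false rewrite dec-true (any-true? (λ y → adj T x y ∧ reach j y)) (y , cong₂ _∧_ xy reach-y) = refl

  walkLength : ∀ {x y} → Walk T x y → ℕ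
  walkLength here = 0
  walkLength (step _ w) = suc (walkLength w)

  reach-walk : ∀ {x} (w : Walk T x r) → reach (walkLength w) x ≡ true
  reach-walk here = dec-true (r ≟ r) refl
  reach-walk (step xz w) = reach-step (walkLength w) xz (reach-walk w)

  bound : Fin n → ℕ
  bound x = walkLength (connected x r)

  depth : Fin n → ℕ
  depth x = least (λ j → reach j x) (bound x)

  reach-depth : ∀ x → reach (depth x) x ≡ true
  reach-depth x = least-holds (λ j → reach j x) (bound x) (reach-walk (connected x r))

  depth-≤ : ∀ {j x} → reach j x ≡ true → depth x ≤ j
  depth-≤ {j} {x} reach-x = ≮⇒≥ λ j<depth →
    contradiction (trans (sym reach-x) (least-minimal (λ j → reach j x) (bound x) j<depth)) λ ()

  depth-root : depth r ≡ 0
  depth-root = n≤0⇒n≡0 (depth-≤ (dec-true (r ≟ r) refl))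

  depth-zero : ∀ {x} → depth x ≡ 0 → x ≡ r
  depth-zero {x} d≡0 = ==-≡ (subst (λ d → reach d x ≡ true) d≡0 (reach-depth x))

  depth-adj : ∀ {x y} → Adj T x y → depth y ≤ suc (depth x)
  depth-adj {x} xy = depth-≤ (reach-step (depth x) (Adj-sym T xy) (reach-depth x))

  parentAt : ℕ → Fin n → Fin n
  parentAt zero x = x
  parentAt (suc d) x with any-true? (λ y → adj T x y ∧ reach d y)
  ... | yes (y , _) = y
  ... | no _ = x

  parent : Fin n → Fin n
  parent x = parentAt (depth x) x

  parentAt-spec : ∀ {x d} → depth x ≡ suc d → Adj T x (parentAt (suc d) x) × depth (parentAt (suc d) x) ≡ d
  parentAt-spec {x} {d} dx with any-true? (λ y → adj T x y ∧ reach d y) | subst (λ k → reach k x ≡ true) dx (reach-depth x)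
  ... | yes (y , found) | _ = xy , ≤-antisym (depth-≤ (proj₂ (∧-true found))) d≤depth-y
    where
    xy : Adj T x y
    xy = proj₁ (∧-true found)
    d≤depth-y : d ≤ depth y
    d≤depth-y = ≤-pred (subst (_≤ suc (depth y)) dx (depth-adj (Adj-sym T xy)))
  ... | no _ | reach-x = ⊥-elim (1+n≰n (subst (_≤ d) dx (depth-≤ (trans (sym (∨-identityʳ (reach d x))) reach-x))))

  parent-spec : ∀ {x d} → depth x ≡ suc d → Adj T x (parent x) × depth (parent x) ≡ d
  parent-spec {x} {d} dx = subst (λ k → Adj T x (parentAt k x) × depth (parentAt k x) ≡ d) (sym dx) (parentAt-spec dx)

  ≢-deeper : ∀ {d y z} → depth y ≡ d → suc d ≤ depth z → y ≢ z
  ≢-deeper {z = z} dy deep refl = 1+n≰n (subst (λ k → suc k ≤ depth z) (sym dy) deep)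

  -- Climbing from both ends to the parents until they coincide closes a cycle.
  no-level-path : ∀ d p M q → depth p ≡ d → depth q ≡ d → p ≢ q → Linked (Adj T) (p ∷ M ∷ʳ q) →
                 Unique (p ∷ M ∷ʳ q) → All (λ z → d ≤ depth z) M → ⊥
  no-level-path zero p M q dp dq p≢q _ _ _ = p≢q (trans (depth-zero dp) (sym (depth-zero dq)))
  no-level-path (suc d) p M q dp dq p≢q linked unique deep
    with parent-spec dp | parent-spec dq | ≤-reflexive (sym dp) ∷ ∷ʳ⁺ deep (≤-reflexive (sym dq))
  ... | p-p′ , dp′ | q-q′ , dq′ | path-deep with parent p ≟ parent q
  ...   | yes p′≡q′ = acyclic (pathCycle T (parent p) p M q (Adj-sym T p-p′ ∷ linked)
                        (All.map (≢-deeper dp′) path-deep ∷ unique) (subst (Adj T q) (sym p′≡q′) q-q′))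
  ...   | no p′≢q′ = no-level-path d (parent p) (p ∷ M ∷ʳ q) (parent q) dp′ dq′ p′≢q′ linked′ unique′
                                   (All.map (≤-trans (n≤1+n d)) path-deep)
    where
    linked′ : Linked (Adj T) (parent p ∷ (p ∷ M ∷ʳ q) ∷ʳ parent q)
    linked′ = Adj-sym T p-p′ ∷ Linked-∷ʳ p M linked q-q′
    unique′ : Unique (parent p ∷ (p ∷ M ∷ʳ q) ∷ʳ parent q)
    unique′ = ∷ʳ⁺ (All.map (≢-deeper dp′) path-deep) p′≢q′
            ∷ Unique-∷ʳ (p ∷ M ∷ʳ q) unique (All.map (≢-sym ∘ ≢-deeper dq′) path-deep)

  depth-suc : ∀ {x} → x ≢ r → ∃ λ d → depth x ≡ suc d
  depth-suc {x} x≢r with depth x in dx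
  ... | zero = contradiction (depth-zero dx) x≢r
  ... | suc d = d , refl

  parent-adj : ∀ {x} → x ≢ r → Adj T x (parent x)
  parent-adj x≢r = proj₁ (parent-spec (proj₂ (depth-suc x≢r)))

  depth-parent : ∀ {x} → x ≢ r → depth x ≡ suc (depth (parent x))
  depth-parent x≢r with depth-suc x≢r
  ... | d , dx = trans dx (cong suc (sym (proj₂ (parent-spec dx))))

  parent-of-deeper : ∀ {x y} → Adj T x y → depth y ≡ suc (depth x) → parent y ≡ x × y ≢ r
  parent-of-deeper {x} {y} xy dy with parent-spec dy | parent y ≟ x
  ... | _ | yes y′≡x = y′≡x , λ { refl → contradiction (trans (sym dy) depth-root) λ () }
  ... | y-y′ , dy′ | no y′≢x = ⊥-elim (no-level-path (depth x) x (y ∷ []) (parent y) refl dy′ (≢-sym y′≢x)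
                                  (xy ∷ y-y′ ∷ [-]) unique (≤-trans (n≤1+n _) (≤-reflexive (sym dy)) ∷ []))
    where
    unique : Unique (x ∷ y ∷ parent y ∷ [])
    unique = (Adj-irrefl T xy ∷ ≢-sym y′≢x ∷ []) ∷ (Adj-irrefl T y-y′ ∷ []) ∷ [] ∷ []

  edge-parent : ∀ {x y} → Adj T x y → (parent y ≡ x × y ≢ r) ⊎ (parent x ≡ y × x ≢ r)
  edge-parent {x} {y} xy with <-cmp (depth x) (depth y)
  ... | tri< dx<dy _ _ = inj₁ (parent-of-deeper xy (≤-antisym (depth-adj xy) dx<dy))
  ... | tri> _ _ dy<dx = inj₂ (parent-of-deeper (Adj-sym T xy) (≤-antisym (depth-adj (Adj-sym T xy)) dy<dx))
  ... | tri≈ _ dx≡dy _ = ⊥-elim (no-level-path (depth x) x [] y refl (sym dx≡dy) (Adj-irrefl T xy) (xy ∷ [-])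
                                  ((Adj-irrefl T xy ∷ []) ∷ [] ∷ []) [])

  rooting : Rooting T r
  rooting = record
    { parent       = parent
    ; depth        = depth
    ; depth-root   = depth-root
    ; parent-adj   = parent-adj
    ; depth-parent = depth-parent
    ; edge-parent  = edge-parent
    }

module GluedRooting {h k n} {H : Graph h} {v : Fin h} {K : Graph k} {w : Fin k} {G : Graph n} {r : Fin h}
                    (RH : Rooting H r) (RK : Rooting K w) (gl : Glued H v K w G) where

  open Glued gl
  module RH = Rooting RH
  module RK = Rooting RK

  fK≢fH : ∀ {a b} → b ≢ w → fK b ≢ fH a
  fK≢fH b≢w e = b≢w (proj₂ (meet _ _ (sym e)))

  data Side (x : Fin n) : Set where
    inH : ∀ a → fH a ≡ x → Side x
    inK : ∀ b → fK b ≡ x → b ≢ w → Side x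

  side : ∀ x → Side x
  side x with cover x
  ... | inj₁ (a , e) = inH a e
  ... | inj₂ (b , e) with b ≟ w
  ...   | yes refl = inH v (trans glue e)
  ...   | no b≢w = inK b e b≢w

  parentOn : ∀ {x} → Side x → Fin n
  parentOn (inH a _) = fH (RH.parent a)
  parentOn (inK b _ _) = fK (RK.parent b)

  depthOn : ∀ {x} → Side x → ℕ
  depthOn (inH a _) = RH.depth a
  depthOn (inK b _ _) = RH.depth v + RK.depth b

  parent : Fin n → Fin n
  parent x = parentOn (side x)

  depth : Fin n → ℕ
  depth x = depthOn (side x)

  parent-fH : ∀ a → parent (fH a) ≡ fH (RH.parent a)
  parent-fH a = on (side (fH a))
    where
    on : (s : Side (fH a)) → parentOn s ≡ fH (RH.parent a)
    on (inH a′ e) = cong (fH ∘ RH.parent) (fH-inj e)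
    on (inK b e b≢w) = contradiction e (fK≢fH b≢w)

  depth-fH : ∀ a → depth (fH a) ≡ RH.depth a
  depth-fH a = on (side (fH a))
    where
    on : (s : Side (fH a)) → depthOn s ≡ RH.depth a
    on (inH a′ e) = cong RH.depth (fH-inj e)
    on (inK b e b≢w) = contradiction e (fK≢fH b≢w)

  parent-fK : ∀ {b} → b ≢ w → parent (fK b) ≡ fK (RK.parent b)
  parent-fK {b} b≢w = on (side (fK b))
    where
    on : (s : Side (fK b)) → parentOn s ≡ fK (RK.parent b)
    on (inH a e) = contradiction (sym e) (fK≢fH b≢w)
    on (inK b′ e _) = cong (fK ∘ RK.parent) (fK-inj e)

  depth-fK : ∀ b → depth (fK b) ≡ RH.depth v + RK.depth b
  depth-fK b = on (side (fK b))
    where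
    on : (s : Side (fK b)) → depthOn s ≡ RH.depth v + RK.depth b
    on (inH a e) with meet a b e
    ... | refl , refl = trans (sym (+-identityʳ _)) (cong (RH.depth v +_) (sym RK.depth-root))
    on (inK b′ e _) = cong (λ b → RH.depth v + RK.depth b) (fK-inj e)

  parent-adj : ∀ {x} → x ≢ fH r → Adj G x (parent x)
  parent-adj {x} x≢root with side x
  ... | inH a refl = H→G _ _ (RH.parent-adj (x≢root ∘ cong fH))
  ... | inK b refl b≢w = K→G _ _ (RK.parent-adj b≢w)

  depth-parent : ∀ {x} → x ≢ fH r → depth x ≡ suc (depth (parent x))
  depth-parent {x} x≢root with side x
  ... | inH a refl = trans (RH.depth-parent (x≢root ∘ cong fH)) (cong suc (sym (depth-fH (RH.parent a))))
  ... | inK b refl b≢w = begin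
    RH.depth v + RK.depth b                     ≡⟨ cong (RH.depth v +_) (RK.depth-parent b≢w) ⟩
    RH.depth v + suc (RK.depth (RK.parent b))   ≡⟨ +-suc _ _ ⟩
    suc (RH.depth v + RK.depth (RK.parent b))   ≡⟨ cong suc (sym (depth-fK (RK.parent b))) ⟩
    suc (depth (fK (RK.parent b)))              ∎
    where open ≡-Reasoning

  edge-parent : ∀ {x y} → Adj G x y → (parent y ≡ x × y ≢ fH r) ⊎ (parent x ≡ y × x ≢ fH r)
  edge-parent {x} {y} xy with edges→ x y xy
  ... | inj₁ (a , b , refl , refl , ab) with RH.edge-parent ab
  ...   | inj₁ (b↑a , b≢r) = inj₁ (trans (parent-fH b) (cong fH b↑a) , b≢r ∘ fH-inj)
  ...   | inj₂ (a↑b , a≢r) = inj₂ (trans (parent-fH a) (cong fH a↑b) , a≢r ∘ fH-inj)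
  edge-parent {x} {y} xy | inj₂ (a , b , refl , refl , ab) with RK.edge-parent ab
  ...   | inj₁ (b↑a , b≢w) = inj₁ (trans (parent-fK b≢w) (cong fK b↑a) , fK≢fH b≢w)
  ...   | inj₂ (a↑b , a≢w) = inj₂ (trans (parent-fK a≢w) (cong fK a↑b) , fK≢fH a≢w)

  rooting : Rooting G (fH r)
  rooting = record
    { parent       = parent
    ; depth        = depth
    ; depth-root   = trans (depth-fH r) RH.depth-root
    ; parent-adj   = parent-adj
    ; depth-parent = depth-parent
    ; edge-parent  = edge-parent
    }

  parent-preimage : ∀ {a z} → a ≢ v → parent z ≡ fH a → ∃ λ a′ → fH a′ ≡ z × RH.parent a′ ≡ a
  parent-preimage {a} {z} a≢v z↑a with side z
  ... | inH a′ refl = a′ , refl , fH-inj z↑a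
  ... | inK b refl b≢w = contradiction (proj₁ (meet a _ (sym z↑a))) a≢v

-- The colouring rule

next : Fin 3 → Fin 3
next zero = suc zero
next (suc zero) = suc (suc zero)
next (suc (suc zero)) = zero

next-≢ : ∀ a → next a ≢ a
next-≢ zero ()
next-≢ (suc zero) ()
next-≢ (suc (suc zero)) ()

next²-≢ : ∀ a → next (next a) ≢ a
next²-≢ zero ()
next²-≢ (suc zero) ()
next²-≢ (suc (suc zero)) ()

-- What the subtree of a vertex needs from the degree t of its parent in the colour of the edge between them.
data Demand : Set where
  free avoid1 avoid2 : Demand

Meets : Demand → ℕ → Set
Meets free _ = ⊤
Meets avoid1 t = t ≢ 1
Meets avoid2 t = t ≢ 2

meets-≥3 : ∀ d {t} → 3 ≤ t → Meets d t
meets-≥3 free _ = tt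
meets-≥3 avoid1 (s≤s ()) refl
meets-≥3 avoid2 (s≤s (s≤s ())) refl

isAvoid2 : Demand → Bool
isAvoid2 avoid2 = true
isAvoid2 _ = false

dual : Demand → Demand
dual free = free
dual avoid1 = avoid2
dual avoid2 = avoid1

demandOf : ℕ → Demand → Demand
demandOf zero _ = avoid1
demandOf (suc zero) d = dual d
demandOf (suc (suc _)) _ = free

≤1⇒≢2 : ∀ {k} → k ≤ 1 → k ≢ 2
≤1⇒≢2 (s≤s ()) refl

suc≢1 : ∀ {k} → 0 < k → suc k ≢ 1
suc≢1 (s≤s _) ()

-- The rule at a vertex with children ch of demands d (y₀ is one of them, if any), whose parent edge
-- has colour a while the parent has degree t in colour a: `colour z` is the colour of the edge to z.
module LocalRule {n} (ch : Fin n → Bool) (d : Fin n → Demand) (y₀ : Fin n) (y₀-child : 0 < count ch → ch y₀ ≡ true)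
                 (a : Fin 3) (t : ℕ) where

  special? : Dec (∃ λ m → (ch m ∧ isAvoid2 (d m)) ≡ true)
  special? = any-true? (λ m → ch m ∧ isAvoid2 (d m))

  oneChild : Demand → Fin 3
  oneChild free = if does (t ≟ℕ 2) then next a else a
  oneChild avoid1 = a
  oneChild avoid2 = next a

  awayFrom : Demand → Fin 3
  awayFrom avoid1 = a
  awayFrom _ = next (next a)

  twoChildren : Dec (∃ λ m → (ch m ∧ isAvoid2 (d m)) ≡ true) → Fin n → Fin 3
  twoChildren (yes (m , _)) z = if z == m then next a else awayFrom (d z)
  twoChildren (no _) z = next a

  colourFor : ℕ → Fin n → Fin 3
  colourFor zero z = a
  colourFor (suc zero) z = oneChild (d z)
  colourFor (suc (suc zero)) z = if does (t ≟ℕ 3) then twoChildren special? z else a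
  colourFor (suc (suc (suc c))) z = if does (t ≟ℕ 4 + c) then next a else a

  colour : Fin n → Fin 3
  colour = colourFor (count ch)

  childOfColour : Fin 3 → Fin n → Bool
  childOfColour i z = ch z ∧ (colour z == i)

  below : Fin 3 → ℕ
  below i = count (childOfColour i)

  degree : Fin 3 → ℕ
  degree i = indicator (a == i) + below i

  ownDemand : Demand
  ownDemand = demandOf (count ch) (d y₀)

  Sound : Set
  Sound = (Meets ownDemand t → degree a ≢ t) × (∀ z → ch z ≡ true → Meets (d z) (degree (colour z)))

  degree-self : degree a ≡ suc (below a)
  degree-self rewrite dec-true (a ≟ a) refl = refl

  degree-other : ∀ {i} → a ≢ i → degree i ≡ below i
  degree-other {i} a≢i rewrite dec-false (a ≟ i) a≢i = refl

  below-all : ∀ {i} → (∀ z → ch z ≡ true → colour z ≡ i) → below i ≡ count ch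
  below-all {i} all = count-cong (childOfColour i) ch same
    where
    same : ∀ z → childOfColour i z ≡ ch z
    same z with ch z in cz
    ... | true = dec-true (colour z ≟ i) (all z cz)
    ... | false = refl

  below-none : ∀ {i} → (∀ z → ch z ≡ true → colour z ≢ i) → below i ≡ 0
  below-none {i} none = count-none (childOfColour i) other
    where
    other : ∀ z → childOfColour i z ≡ false
    other z with ch z in cz
    ... | true = dec-false (colour z ≟ i) (none z cz)
    ... | false = refl

  below-< : ∀ {i z} → ch z ≡ true → colour z ≢ i → below i < count ch
  below-< {i} {z} cz σz≢i = count-< (childOfColour i) ch (λ z → proj₁ ∘ ∧-true) cz other
    where
    other : childOfColour i z ≡ false
    other rewrite cz = dec-false (colour z ≟ i) σz≢i

  below-pos : ∀ {i z} → ch z ≡ true → colour z ≡ i → 0 < below i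
  below-pos {i} {z} cz σz≡i = count-pos (childOfColour i) hit
    where
    hit : childOfColour i z ≡ true
    hit rewrite cz = dec-true (colour z ≟ i) σz≡i

  sound-stay : (∀ z → ch z ≡ true → colour z ≡ a) → (Meets ownDemand t → suc (count ch) ≢ t) →
               (∀ z → ch z ≡ true → Meets (d z) (suc (count ch))) → Sound
  sound-stay all parent-ok children-ok =
    (λ meets → parent-ok meets ∘ trans (sym stay)) ,
    (λ z cz → subst (Meets (d z)) (sym (trans (cong degree (all z cz)) stay)) (children-ok z cz))
    where
    stay : degree a ≡ suc (count ch)
    stay = trans degree-self (cong suc (below-all all))

  sound-move : (∀ z → ch z ≡ true → colour z ≡ next a) → (Meets ownDemand t → 1 ≢ t) →
               (∀ z → ch z ≡ true → Meets (d z) (count ch)) → Sound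
  sound-move all parent-ok children-ok =
    (λ meets → parent-ok meets ∘ trans (sym alone)) ,
    (λ z cz → subst (Meets (d z)) (sym (trans (cong degree (all z cz)) moved)) (children-ok z cz))
    where
    alone : degree a ≡ 1
    alone = trans degree-self (cong suc (below-none (λ z cz → next-≢ a ∘ trans (sym (all z cz)))))
    moved : degree (next a) ≡ count ch
    moved = trans (degree-other (≢-sym (next-≢ a))) (below-all all)

  colour-at : ∀ {c} → count ch ≡ c → ∀ z → colour z ≡ colourFor c z
  colour-at c≡ z = cong (λ c → colourFor c z) c≡

  ownDemand-at : ∀ {c} → count ch ≡ c → ownDemand ≡ demandOf c (d y₀)
  ownDemand-at c≡ = cong (λ c → demandOf c (d y₀)) c≡

  sound-leaf : count ch ≡ 0 → Sound
  sound-leaf c≡0 = sound-stay (λ z cz → ⊥-elim (no-child cz)) parent-ok (λ z cz → ⊥-elim (no-child cz))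
    where
    no-child : ∀ {z} → ch z ≡ true → ⊥
    no-child cz with subst (0 <_) c≡0 (count-pos ch cz)
    ... | ()
    parent-ok : Meets ownDemand t → suc (count ch) ≢ t
    parent-ok meets rewrite ownDemand-at c≡0 | c≡0 = meets ∘ sym

  module OneChild (c≡1 : count ch ≡ 1) where

    only : ∀ {z} → ch z ≡ true → z ≡ y₀
    only cz = count-unique ch (≤-reflexive c≡1) cz (y₀-child (subst (0 <_) (sym c≡1) (s≤s z≤n)))

    child-is : ∀ {z δ} → ch z ≡ true → d y₀ ≡ δ → d z ≡ δ
    child-is cz dy₀ = trans (cong d (only cz)) dy₀

    own-is : ∀ {δ} → d y₀ ≡ δ → ownDemand ≡ dual δ
    own-is dy₀ = trans (ownDemand-at c≡1) (cong dual dy₀)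

    colour-is : ∀ {z δ} → ch z ≡ true → d y₀ ≡ δ → colour z ≡ oneChild δ
    colour-is {z} cz dy₀ = trans (colour-at c≡1 z) (cong oneChild (child-is cz dy₀))

    sound-by : ∀ δ → d y₀ ≡ δ → Sound
    sound-by avoid1 dy₀ = sound-stay (λ z cz → colour-is cz dy₀) parent-ok child-ok
      where
      parent-ok : Meets ownDemand t → suc (count ch) ≢ t
      parent-ok meets rewrite own-is dy₀ | c≡1 = meets ∘ sym
      child-ok : ∀ z → ch z ≡ true → Meets (d z) (suc (count ch))
      child-ok z cz rewrite child-is cz dy₀ | c≡1 = λ ()
    sound-by avoid2 dy₀ = sound-move (λ z cz → colour-is cz dy₀) parent-ok child-ok
      where
      parent-ok : Meets ownDemand t → 1 ≢ t
      parent-ok meets rewrite own-is dy₀ = meets ∘ sym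
      child-ok : ∀ z → ch z ≡ true → Meets (d z) (count ch)
      child-ok z cz rewrite child-is cz dy₀ | c≡1 = λ ()
    sound-by free dy₀ with t ≟ℕ 2
    ... | yes t≡2 = sound-move (λ z cz → trans (colour-is cz dy₀) moves) (λ _ → 1≢t) child-ok
      where
      moves : oneChild free ≡ next a
      moves rewrite dec-true (t ≟ℕ 2) t≡2 = refl
      1≢t : 1 ≢ t
      1≢t 1≡t = contradiction (trans 1≡t t≡2) λ ()
      child-ok : ∀ z → ch z ≡ true → Meets (d z) (count ch)
      child-ok z cz rewrite child-is cz dy₀ = tt
    ... | no t≢2 = sound-stay (λ z cz → trans (colour-is cz dy₀) stays) parent-ok child-ok
      where
      stays : oneChild free ≡ a
      stays rewrite dec-false (t ≟ℕ 2) t≢2 = refl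
      parent-ok : Meets ownDemand t → suc (count ch) ≢ t
      parent-ok _ rewrite c≡1 = t≢2 ∘ sym
      child-ok : ∀ z → ch z ≡ true → Meets (d z) (suc (count ch))
      child-ok z cz rewrite child-is cz dy₀ = tt

  sound-one : count ch ≡ 1 → Sound
  sound-one c≡1 = OneChild.sound-by c≡1 (d y₀) refl

  sound-many : ∀ {c} → count ch ≡ 3 + c → Sound
  sound-many {c} c≡ with t ≟ℕ 4 + c | subst (3 ≤_) (sym c≡) (s≤s (s≤s (s≤s z≤n)))
  ... | yes t≡ | many = sound-move (λ z _ → trans (colour-at c≡ z) moves) (λ _ 1≡t → contradiction (trans 1≡t t≡) λ ())
                                   (λ z _ → meets-≥3 (d z) many)
    where
    moves : (if does (t ≟ℕ 4 + c) then next a else a) ≡ next a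
    moves rewrite dec-true (t ≟ℕ 4 + c) t≡ = refl
  ... | no t≢ | many = sound-stay (λ z _ → trans (colour-at c≡ z) stays) parent-ok (λ z _ → meets-≥3 (d z) (m≤n⇒m≤1+n many))
    where
    stays : (if does (t ≟ℕ 4 + c) then next a else a) ≡ a
    stays rewrite dec-false (t ≟ℕ 4 + c) t≢ = refl
    parent-ok : Meets ownDemand t → suc (count ch) ≢ t
    parent-ok _ rewrite c≡ = t≢ ∘ sym

  sound-special : count ch ≡ 2 → t ≡ 3 → ∀ {m} → (ch m ∧ isAvoid2 (d m)) ≡ true →
                  (∀ z → ch z ≡ true → colour z ≡ (if z == m then next a else awayFrom (d z))) → Sound
  sound-special c≡2 t≡3 {m} m-special colours = parent-ok , child-ok
    where
    cm : ch m ≡ true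
    cm = proj₁ (∧-true m-special)
    dm : d m ≡ avoid2
    dm with d m | proj₂ (∧-true {ch m} m-special)
    ... | avoid2 | _ = refl
    m-next : colour m ≡ next a
    m-next rewrite colours m cm | dec-true (m ≟ m) refl = refl
    others : ∀ {z} → ch z ≡ true → z ≢ m → colour z ≡ awayFrom (d z)
    others {z} cz z≢m rewrite colours z cz | dec-false (z ≟ m) z≢m = refl
    awayFrom-≢ : ∀ δ → awayFrom δ ≢ next a
    awayFrom-≢ avoid1 = ≢-sym (next-≢ a)
    awayFrom-≢ avoid2 = next-≢ (next a)
    awayFrom-≢ free = next-≢ (next a)
    only-m : ∀ z → childOfColour (next a) z ≡ true → (z == m) ≡ true
    only-m z hit with z ≟ m | ∧-true {ch z} hit
    ... | yes _ | _ = refl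
    ... | no z≢m | cz , z-next = ⊥-elim (awayFrom-≢ (d z) (trans (sym (others cz z≢m)) (==-≡ z-next)))
    below-next≤1 : below (next a) ≤ 1
    below-next≤1 = ≤-trans (count-mono (childOfColour (next a)) (_== m) only-m) (≤-reflexive (count-point m))
    beside-m : ∀ {i} → next a ≢ i → below i ≤ 1
    beside-m next≢i = ≤-pred (subst (below _ <_) c≡2 (below-< cm (next≢i ∘ trans (sym m-next))))
    parent-ok : Meets ownDemand t → degree a ≢ t
    parent-ok _ deg≡t = <⇒≢ (s≤s (s≤s (beside-m (next-≢ a)))) (trans (sym degree-self) (trans deg≡t t≡3))
    child-ok : ∀ z → ch z ≡ true → Meets (d z) (degree (colour z))
    child-ok z cz with z ≟ m
    ... | yes refl rewrite dm | m-next | degree-other (≢-sym (next-≢ a)) = ≤1⇒≢2 below-next≤1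
    ... | no z≢m with d z in dz
    ...   | free = tt
    ...   | avoid1 rewrite trans (others cz z≢m) (cong awayFrom dz) | degree-self =
      suc≢1 (below-pos cz (trans (others cz z≢m) (cong awayFrom dz)))
    ...   | avoid2 rewrite trans (others cz z≢m) (cong awayFrom dz) | degree-other (≢-sym (next²-≢ a)) =
      ≤1⇒≢2 (beside-m (≢-sym (next-≢ (next a))))

  sound-two : count ch ≡ 2 → Sound
  sound-two c≡2 with t ≟ℕ 3
  ... | no t≢3 = sound-stay (λ z _ → trans (colour-at c≡2 z) stays) parent-ok (λ z _ → meets-≥3 (d z) three)
    where
    stays : ∀ {z} → (if does (t ≟ℕ 3) then twoChildren special? z else a) ≡ a
    stays rewrite dec-false (t ≟ℕ 3) t≢3 = refl
    parent-ok : Meets ownDemand t → suc (count ch) ≢ t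
    parent-ok _ rewrite c≡2 = t≢3 ∘ sym
    three : 3 ≤ suc (count ch)
    three rewrite c≡2 = ≤-refl
  ... | yes t≡3 with special? in sp
  ...   | yes (m , m-special) = sound-special c≡2 t≡3 m-special (λ z _ → trans (colour-at c≡2 z) split)
    where
    split : ∀ {z} → (if does (t ≟ℕ 3) then twoChildren special? z else a) ≡ (if z == m then next a else awayFrom (d z))
    split rewrite dec-true (t ≟ℕ 3) t≡3 | sp = refl
  ...   | no none = sound-move (λ z _ → trans (colour-at c≡2 z) moves) (λ _ 1≡t → contradiction (trans 1≡t t≡3) λ ()) child-ok
    where
    moves : ∀ {z} → (if does (t ≟ℕ 3) then twoChildren special? z else a) ≡ next a
    moves rewrite dec-true (t ≟ℕ 3) t≡3 | sp = refl
    child-ok : ∀ z → ch z ≡ true → Meets (d z) (count ch)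
    child-ok z cz rewrite c≡2 with d z in dz
    ... | free = tt
    ... | avoid1 = λ ()
    ... | avoid2 = ⊥-elim (none (z , cong₂ _∧_ cz (cong isAvoid2 dz)))

  sound : Sound
  sound = by (count ch) refl
    where
    by : ∀ c → count ch ≡ c → Sound
    by zero = sound-leaf
    by (suc zero) = sound-one
    by (suc (suc zero)) = sound-two
    by (suc (suc (suc c))) = sound-many

-- Colouring a rooted graph

module Demands {n} {G : Graph n} {r : Fin n} (R : Rooting G r) where

  open Rooting R

  someChild : Fin n → Fin n
  someChild x with any-true? (child x)
  ... | yes (z , _) = z
  ... | no _ = x

  someChild-child : ∀ x → 0 < children x → child x (someChild x) ≡ true
  someChild-child x pos with any-true? (child x)
  ... | yes (z , cz) = cz
  ... | no none = contradiction (count-witness (child x) pos) none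

  maxDepth : ℕ
  maxDepth = max 0 (map depth (allFin n))

  depth≤max : ∀ x → depth x ≤ maxDepth
  depth≤max x = v≤max⁺ 0 (map depth (allFin n)) (inj₂ (Any.map (λ { refl → ≤-refl }) (∈-map⁺ depth (∈-allFin x))))

  -- The fuel maxDepth ∸ depth x bounds the height of the subtree below x.
  demandFuel : ℕ → Fin n → Demand
  demandFuel zero x = avoid1
  demandFuel (suc f) x = demandOf (children x) (demandFuel f (someChild x))

  demand : Fin n → Demand
  demand x = demandFuel (maxDepth ∸ depth x) x

  demandFuel-leaf : ∀ {x} → children x ≡ 0 → ∀ f → demandFuel f x ≡ avoid1
  demandFuel-leaf c≡0 zero = refl
  demandFuel-leaf c≡0 (suc f) rewrite c≡0 = refl

  demand-eq : ∀ x → demand x ≡ demandOf (children x) (demand (someChild x))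
  demand-eq x with children x in c≡
  ... | zero = demandFuel-leaf c≡ (maxDepth ∸ depth x)
  ... | suc c with someChild-child x (subst (0 <_) (sym c≡) (s≤s z≤n)) | maxDepth ∸ depth x in fuel
  ...   | cy | zero = ⊥-elim (1+n≰n (≤-trans (≤-trans (≤-reflexive (sym (depth-child cy))) (depth≤max (someChild x)))
                                               (m∸n≡0⇒m≤n fuel)))
  ...   | cy | suc f = cong₂ demandOf c≡ (cong (λ k → demandFuel k (someChild x)) f≡)
    where
    f≡ : f ≡ maxDepth ∸ depth (someChild x)
    f≡ = begin
      f                              ≡⟨ cong pred (sym fuel) ⟩
      pred (maxDepth ∸ depth x)      ≡⟨ pred[m∸n]≡m∸[1+n] maxDepth (depth x) ⟩
      maxDepth ∸ suc (depth x)       ≡⟨ cong (maxDepth ∸_) (sym (depth-child cy)) ⟩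
      maxDepth ∸ depth (someChild x) ∎
      where open ≡-Reasoning

module Colouring {n} {G : Graph n} {r : Fin n} (R : Rooting G r) where

  open Rooting R
  open Demands R

  rootColour : Fin 3
  rootColour = zero

  module Rule (x : Fin n) = LocalRule (child x) demand (someChild x) (someChild-child x)

  childColour : Fin n → Fin 3 × ℕ → Fin n → Fin 3
  childColour x (a , t) z = if x == r then rootColour else Rule.colour x a t z

  degreeFrom : Fin n → Fin 3 × ℕ → Fin 3 → ℕ
  degreeFrom x (a , t) i = indicator (not (x == r) ∧ (a == i)) + count (λ z → child x z ∧ (childColour x (a , t) z == i))

  -- The colour of the edge from x to its parent and the degree of the parent in that colour are
  -- determined by the same pair for the parent, so depth x is enough fuel.
  childEdge : Fin n → Fin 3 × ℕ → Fin 3 × ℕ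
  childEdge x s = childColour (parent x) s x , degreeFrom (parent x) s (childColour (parent x) s x)

  parentEdgeFuel : ℕ → Fin n → Fin 3 × ℕ
  parentEdgeFuel zero x = rootColour , 0
  parentEdgeFuel (suc k) x = childEdge x (parentEdgeFuel k (parent x))

  parentEdge : Fin n → Fin 3 × ℕ
  parentEdge x = parentEdgeFuel (depth x) x

  parentColour : Fin n → Fin 3
  parentColour x = proj₁ (parentEdge x)

  parentDegree : Fin n → ℕ
  parentDegree x = proj₂ (parentEdge x)

  degreeIn : Fin n → Fin 3 → ℕ
  degreeIn x = degreeFrom x (parentEdge x)

  module At (x : Fin n) = Rule x (parentColour x) (parentDegree x)

  parentEdge-step : ∀ {x} → x ≢ r → parentEdge x ≡ childEdge x (parentEdge (parent x))
  parentEdge-step x≢r rewrite depth-parent x≢r = refl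

  parentColour-child : ∀ {x z} → child x z ≡ true → parentColour z ≡ childColour x (parentEdge x) z
  parentColour-child cz with child-elim cz
  ... | refl , z≢r = cong proj₁ (parentEdge-step z≢r)

  parentDegree-eq : ∀ {z} → z ≢ r → parentDegree z ≡ degreeIn (parent z) (parentColour z)
  parentDegree-eq z≢r = trans (cong proj₂ descent) (cong (degreeIn _) (sym (cong proj₁ descent)))
    where
    descent : parentEdge _ ≡ childEdge _ (parentEdge _)
    descent = parentEdge-step z≢r

  parentColour-under : ∀ {x z} → child x z ≡ true → x ≢ r → parentColour z ≡ At.colour x z
  parentColour-under {x} cz x≢r rewrite parentColour-child cz | dec-false (x ≟ r) x≢r = refl

  parentColour-under-root : ∀ {z} → child r z ≡ true → parentColour z ≡ rootColour
  parentColour-under-root cz rewrite parentColour-child cz | dec-true (r ≟ r) refl = refl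

  degreeIn-nonroot : ∀ {x} → x ≢ r → ∀ i → degreeIn x i ≡ At.degree x i
  degreeIn-nonroot {x} x≢r i rewrite dec-false (x ≟ r) x≢r = refl

  degreeIn-root : ∀ i → degreeIn r i ≡ count (λ z → child r z ∧ (rootColour == i))
  degreeIn-root i rewrite dec-true (r ≟ r) refl = refl

  degreeIn-children : ∀ x i →
    degreeIn x i ≡ indicator (not (x == r) ∧ (parentColour x == i)) + count (λ z → child x z ∧ (parentColour z == i))
  degreeIn-children x i = cong (indicator (not (x == r) ∧ (parentColour x == i)) +_)
                               (count-cong _ (λ z → child x z ∧ (parentColour z == i)) same)
    where
    same : ∀ z → (child x z ∧ (childColour x (parentEdge x) z == i)) ≡ (child x z ∧ (parentColour z == i))
    same z with child x z in cz
    ... | true = cong (_== i) (sym (parentColour-child cz))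
    ... | false = refl

  module _ (branching : 3 ≤ children r) where

    parentDegree-under-root : ∀ {z} → child r z ≡ true → parentDegree z ≡ children r
    parentDegree-under-root {z} cz with child-elim cz
    ... | z↑r , z≢r = begin
      parentDegree z                                       ≡⟨ parentDegree-eq z≢r ⟩
      degreeIn (parent z) (parentColour z)                 ≡⟨ cong₂ degreeIn z↑r (parentColour-under-root cz) ⟩
      degreeIn r rootColour                                ≡⟨ degreeIn-root rootColour ⟩
      count (λ y → child r y ∧ (rootColour == rootColour)) ≡⟨ count-cong _ (child r) (∧-identityʳ ∘ child r) ⟩
      children r                                           ∎
      where open ≡-Reasoning

    demand-met : ∀ {z} → z ≢ r → Meets (demand z) (parentDegree z)
    demand-met {z} z≢r with parent z ≟ r
    ... | yes z↑r = meets-≥3 (demand z) (subst (3 ≤_) (sym (parentDegree-under-root (child-intro z↑r z≢r))) branching)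
    ... | no x≢r = subst (Meets (demand z)) (sym degree≡) (proj₂ (At.sound x) z cz)
      where
      x = parent z
      cz = child-intro refl z≢r
      degree≡ : parentDegree z ≡ At.degree x (At.colour x z)
      degree≡ = trans (parentDegree-eq z≢r) (trans (degreeIn-nonroot x≢r _) (cong (At.degree x) (parentColour-under cz x≢r)))

    parent-irregular : ∀ {x} → x ≢ r → degreeIn x (parentColour x) ≢ parentDegree x
    parent-irregular {x} x≢r = proj₁ (At.sound x) meets ∘ trans (sym (degreeIn-nonroot x≢r (parentColour x)))
      where
      meets : Meets (At.ownDemand x) (parentDegree x)
      meets = subst (λ δ → Meets δ (parentDegree x)) (demand-eq x) (demand-met x≢r)

  -- An edge takes the parent-edge colour of its deeper end; the value on non-edges is irrelevant.
  edgeColour : Fin n → Fin n → Fin 3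
  edgeColour x y = if depth x <ᵇ depth y then parentColour y else if depth y <ᵇ depth x then parentColour x else rootColour

  edgeColour-sym : ∀ x y → edgeColour x y ≡ edgeColour y x
  edgeColour-sym x y with depth x <ᵇ depth y | <ᵇ⇒< (depth x) (depth y) | depth y <ᵇ depth x | <ᵇ⇒< (depth y) (depth x)
  ... | true | x<y | true | y<x = ⊥-elim (<-asym (x<y tt) (y<x tt))
  ... | true | _ | false | _ = refl
  ... | false | _ | true | _ = refl
  ... | false | _ | false | _ = refl

  edgeColour-child : ∀ {x z} → child x z ≡ true → edgeColour x z ≡ parentColour z
  edgeColour-child {x} {z} cz with depth x <ᵇ depth z | <⇒<ᵇ (≤-reflexive (sym (depth-child cz)))
  ... | true | _ = refl

  colouring : EdgeColoring3 G
  colouring = record { col = edgeColour ; col-sym = edgeColour-sym }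

  parent-term-zero : ∀ {x y} b → (child y x ≡ true → ⊥) → ((y == parent x) ∧ (not (x == r) ∧ b)) ≡ false
  parent-term-zero {x} {y} b not-child with y ≟ parent x | x ≟ r | child-intro {y} {x}
  ... | no _ | _ | _ = refl
  ... | yes _ | yes _ | _ = refl
  ... | yes y≡x↑ | no x≢r | intro = ⊥-elim (not-child (intro (sym y≡x↑) x≢r))

  neighbour-split : ∀ x i y →
    indicator (adj G x y ∧ (edgeColour x y == i)) ≡
    indicator ((y == parent x) ∧ (not (x == r) ∧ (parentColour x == i))) + indicator (child x y ∧ (parentColour y == i))
  neighbour-split x i y with adj G x y in xy
  ... | false rewrite parent-term-zero (parentColour x == i) (non-adjacent G xy ∘ Adj-sym G ∘ child-adj)
                    | ¬-not (non-adjacent G xy ∘ child-adj) = refl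
  ... | true with edge-parent xy
  ...   | inj₁ (refl , y≢r) rewrite edgeColour-child (child-intro refl y≢r) | child-intro refl y≢r
                                 | parent-term-zero (parentColour x == i) (child-asym (child-intro refl y≢r)) = refl
  ...   | inj₂ (refl , x≢r) rewrite edgeColour-sym x (parent x) | edgeColour-child (child-intro refl x≢r)
                                 | dec-true (parent x ≟ parent x) refl | dec-false (x ≟ r) x≢r
                                 | ¬-not (λ cy → child-asym cy (child-intro refl x≢r)) =
    sym (+-identityʳ _)

  colDeg-eq : ∀ x i → colDeg colouring i x ≡ degreeIn x i
  colDeg-eq x i = begin
    colDeg colouring i x                                           ≡⟨ count-cong _ _ (λ y → cong (adj G x y ∧_) (isYes≗does _)) ⟩
    count (λ y → adj G x y ∧ (edgeColour x y == i))                 ≡⟨ count-+ _ _ _ (neighbour-split x i) ⟩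
    count (λ y → (y == parent x) ∧ viaParent) + count viaChildren  ≡⟨ cong (_+ count viaChildren) (count-at (parent x) viaParent) ⟩
    indicator viaParent + count viaChildren                        ≡⟨ sym (degreeIn-children x i) ⟩
    degreeIn x i                                                   ∎
    where
    open ≡-Reasoning
    viaParent = not (x == r) ∧ (parentColour x == i)
    viaChildren = λ z → child x z ∧ (parentColour z == i)

  parent-edge-irregular : 3 ≤ children r → ∀ {z} → z ≢ r →
                          colDeg colouring (parentColour z) (parent z) ≢ colDeg colouring (parentColour z) z
  parent-edge-irregular branching {z} z≢r same rewrite colDeg-eq (parent z) (parentColour z) | colDeg-eq z (parentColour z) =
    parent-irregular branching z≢r (trans (sym same) (sym (parentDegree-eq z≢r)))

  liec : 3 ≤ children r → Is3Liec colouring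
  liec branching x y xy with edge-parent xy
  ... | inj₁ (refl , y≢r) rewrite edgeColour-child (child-intro refl y≢r) = parent-edge-irregular branching y≢r
  ... | inj₂ (refl , x≢r) rewrite edgeColour-sym x (parent x) | edgeColour-child (child-intro refl x≢r) =
    parent-edge-irregular branching x≢r ∘ sym

  edgeColour-root : ∀ {z} → child r z ≡ true → edgeColour r z ≡ rootColour
  edgeColour-root cz = trans (edgeColour-child cz) (parentColour-under-root cz)

  edgeColour-pendant : ∀ {x y} → x ≢ r → children x ≡ 1 → child x y ≡ true → children y ≡ 0 →
                       edgeColour x y ≡ parentColour x
  edgeColour-pendant {x} {y} x≢r one cy leaf = begin
    edgeColour x y               ≡⟨ edgeColour-child cy ⟩
    parentColour y               ≡⟨ parentColour-under cy x≢r ⟩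
    At.colour x y                ≡⟨ At.colour-at x one y ⟩
    At.oneChild x (demand y)     ≡⟨ cong (At.oneChild x) leaf-demand ⟩
    parentColour x               ∎
    where
    open ≡-Reasoning
    leaf-demand : demand y ≡ avoid1
    leaf-demand = trans (demand-eq y) (cong (λ c → demandOf c (demand (someChild y))) leaf)

-- Spideys

module RootedSpidey {h} {H : Graph h} {u v : Fin h} (RH : Rooting H u)
                    (deg-others : ∀ x → x ≢ u → deg H x ≤ 2)
                    (near : ∀ x → x ≡ u ⊎ Adj H u x ⊎ (∃ λ y → Adj H u y × Adj H y x))
                    (uv : Adj H u v) (deg-leg : deg H v ≡ 1) where

  open Rooting RH

  depth≤2 : ∀ x → depth x ≤ 2
  depth≤2 x with near x
  ... | inj₁ refl = ≤-trans (≤-reflexive depth-root) z≤n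
  ... | inj₂ (inj₁ ux) = ≤-trans (depth-adj ux) (s≤s (≤-trans (≤-reflexive depth-root) z≤n))
  ... | inj₂ (inj₂ (y , uy , yx)) =
    ≤-trans (depth-adj yx) (s≤s (≤-trans (depth-adj uy) (s≤s (≤-trans (≤-reflexive depth-root) z≤n))))

  centre-child : ∀ {x} → Adj H u x → child u x ≡ true
  centre-child ux with edge-parent ux
  ... | inj₁ (x↑u , x≢u) = child-intro x↑u x≢u
  ... | inj₂ (_ , u≢u) = ⊥-elim (u≢u refl)

  module OuterEdge {a b} (ab : child a b ≡ true) (a≢u : a ≢ u) where

    depth-a : depth a ≡ 1
    depth-a = ≤-antisym (≤-pred (subst (_≤ 2) (depth-child ab) (depth≤2 b)))
                        (subst (1 ≤_) (sym (depth-parent a≢u)) (s≤s z≤n))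

    inner : child u a ≡ true
    inner = child-intro (depth-zero (ℕ.suc-injective (trans (sym (depth-parent a≢u)) depth-a))) a≢u

    a≢v : a ≢ v
    a≢v refl = proj₂ (child-elim ab) (count-unique (adj H v) (≤-reflexive deg-leg) (child-adj ab) (Adj-sym H uv))

    b≢v : b ≢ v
    b≢v refl = 1+n≰n (≤-trans (≤-reflexive (trans (cong suc (sym depth-a)) (sym (depth-child ab))))
                              (subst (λ d → depth v ≤ suc d) depth-root (depth-adj uv)))

    only-child : ∀ {c} → child a c ≡ true → c ≡ b
    only-child {c} ac = count-unique (adj H a ∖ u) at-most-one (other ac) (other ab)
      where
      at-most-one : count (adj H a ∖ u) ≤ 1
      at-most-one = ≤-pred (subst (_≤ 2) (count-remove (adj H a) (Adj-sym H (child-adj inner))) (deg-others a a≢u))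
      other : ∀ {z} → child a z ≡ true → (adj H a ∖ u) z ≡ true
      other az = ∖-intro (adj H a) (child-adj az) (proj₂ (child-elim az))

    childless : ∀ {c} → child b c ≡ true → ⊥
    childless bc = 1+n≰n (≤-trans (≤-reflexive depth-c) (depth≤2 _))
      where
      depth-c : 3 ≡ depth _
      depth-c = sym (trans (depth-child bc) (cong suc (trans (depth-child ab) (cong suc depth-a))))

module SpideyGlued {h k n} {H : Graph h} {v : Fin h} {K : Graph k} {w : Fin k} {G : Graph n} {u : Fin h}
                   (RH : Rooting H u) (RK : Rooting K w) (gl : Glued H v K w G)
                   (deg-centre : 3 ≤ deg H u) (deg-others : ∀ x → x ≢ u → deg H x ≤ 2)
                   (near : ∀ x → x ≡ u ⊎ Adj H u x ⊎ (∃ λ y → Adj H u y × Adj H y x))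
                   (uv : Adj H u v) (deg-leg : deg H v ≡ 1) where

  open Glued gl
  open GluedRooting RH RK gl using (rooting; parent-fH; parent-preimage)
  module H = Rooting RH
  open RootedSpidey RH deg-others near uv deg-leg
  open Rooting rooting using (child; children; child-intro; child-elim)
  open Colouring rooting public

  child-fH : ∀ {a a′} → H.child a a′ ≡ true → child (fH a) (fH a′) ≡ true
  child-fH aa′ with H.child-elim aa′
  ... | a′↑a , a′≢u = child-intro (trans (parent-fH _) (cong fH a′↑a)) (a′≢u ∘ fH-inj)

  child-preimage : ∀ {a z} → a ≢ v → child (fH a) z ≡ true → ∃ λ a′ → fH a′ ≡ z × H.child a a′ ≡ true
  child-preimage a≢v cz with child-elim cz
  ... | z↑ , z≢root with parent-preimage a≢v z↑
  ... | a′ , refl , a′↑a = a′ , refl , H.child-intro a′↑a (z≢root ∘ cong fH)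

  branching : 3 ≤ children (fH u)
  branching = ≤-trans deg-centre (count-≤-injective (adj H u) (child (fH u)) fH-inj (λ x → child-fH ∘ centre-child))

  edge-rootColour : ∀ {a b} → H.child a b ≡ true → edgeColour (fH a) (fH b) ≡ rootColour
  edge-rootColour {a} {b} ab with a ≟ u
  ... | yes refl = edgeColour-root (child-fH ab)
  ... | no a≢u = trans (edgeColour-pendant (a≢u ∘ fH-inj) one-child (child-fH ab) no-child)
                       (parentColour-under-root (child-fH inner))
    where
    open OuterEdge ab a≢u
    one-child : children (fH a) ≡ 1
    one-child = count-one (child (fH a)) (child-fH ab) only-fH-b
      where
      only-fH-b : ∀ z → child (fH a) z ≡ true → z ≡ fH b
      only-fH-b z cz with child-preimage a≢v cz
      ... | c , refl , ac = cong fH (only-child ac)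
    no-child : children (fH b) ≡ 0
    no-child = count-none (child (fH b)) (λ z → ¬-not (λ cz → childless (proj₂ (proj₂ (child-preimage b≢v cz)))))

  H-monochromatic : ∀ a b → Adj H a b → edgeColour (fH a) (fH b) ≡ rootColour
  H-monochromatic a b ab with H.edge-parent ab
  ... | inj₁ (b↑a , b≢u) = edge-rootColour (H.child-intro b↑a b≢u)
  ... | inj₂ (a↑b , a≢u) = trans (edgeColour-sym (fH a) (fH b)) (edge-rootColour (H.child-intro a↑b a≢u))

mainTheorem2 : ∀ {h k n} (H : Graph h) (v : Fin h) (K : Graph k) (w : Fin k)
                 (G : Graph n) →
                 IsSpideyWithShortLeg H v → IsTree K →
                 (gl : Glued H v K w G) →
                 Σ (EdgeColoring3 G) λ c → Is3Liec c ×
                   ∃ λ (i : Fin 3) → ∀ a b → Adj H a b →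
                     col c (Glued.fH gl a) (Glued.fH gl b) ≡ i
mainTheorem2 H v K w G ((_ , connected-H , acyclic-H) , u , (deg-centre , deg-others , near) , uv , deg-leg)
             (_ , connected-K , acyclic-K) gl =
  colouring , liec branching , rootColour , H-monochromatic
  where
  open SpideyGlued (TreeRooting.rooting H u connected-H acyclic-H) (TreeRooting.rooting K w connected-K acyclic-K)
                   gl deg-centre deg-others near uv deg-leg
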